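{- Let $s > r \ge 2$, let $c = \frac{1}{4r^2}$, and let $G=(V,E)$ be an $n$-vertex $K_s$-saturated graph with at most $\mathrm{sat}(n,K_r,K_s) + cn$ copies of $K_r$. Let $E_1$ be the set of edges of $G$ contained in at least one copy of $K_r$, $G_1=(V,E_1)$, $A = \{v \in V : d_{G_1}(v) \le n^{1/3}\}$, $B$ the set of vertices $v \in A$ for which there exist $a_1,\dots,a_{s-2} \in V\setminus A$ such that $v,a_1,\dots,a_{s-2}$ induce a copy of $K_{s-1}$, and $C = \{v \in B : d_{G_1}(v) > s-2\}$. Let $v \in B \setminus C$ and let $x_1,\dots,x_{s-2}$ be vertices of $G$ such that $\{v,x_1,\dots,x_{s-2}\}$ induces a copy of $K_{s-1}$. Then every vertex $u \in V \setminus \{v\}$ with $uv \notin E$ is adjacent to all of $x_1,\dots,x_{s-2}$.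
   Context: A graph $G$ is $K_s$-saturated if $G$ contains no copy of $K_s$ but adding any edge to $G$ creates a copy of $K_s$. $\mathrm{sat}(n,K_r,K_s)$ is the minimum number of copies of $K_r$ in an $n$-vertex $K_s$-saturated graph. $d_H(v)$ is the degree of $v$ in $H$. -}

module Defs where

open import Data.Nat using (ℕ; zero; suc; _+_; _*_; _∸_; _^_; _≤_; _<_)
open import Data.Bool using (Bool; true; false; _∧_; _∨_; not; if_then_else_)
open import Data.Fin using (Fin; _≟_)
open import Data.Fin.Subset using (Subset; ∣_∣)
open import Data.Vec using (Vec; []; _∷_; lookup)
open import Data.List using (List; []; _∷_; map; _++_; allFin)
open import Data.Bool.ListAction using (all; any)
open import Data.Nat.ListAction using (sum)
open import Data.Product using (Σ; _×_; ∃)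
open import Relation.Nullary using (¬_)
open import Relation.Nullary.Decidable using (⌊_⌋)
open import Relation.Binary.PropositionalEquality using (_≡_; _≢_)

record SimpleGraph (n : ℕ) : Set where
  field
    adj    : Fin n → Fin n → Bool
    sym    : ∀ i j → adj i j ≡ adj j i
    irrefl : ∀ i → adj i i ≡ false
open SimpleGraph public

module _ {n : ℕ} (G : SimpleGraph n) where

  E : Fin n → Fin n → Set
  E i j = adj G i j ≡ true

  eqᵇ : Fin n → Fin n → Bool
  eqᵇ i j = ⌊ i ≟ j ⌋

  cliqueᵇ : Subset n → Bool
  cliqueᵇ S = all (λ i → all (λ j →
     not (lookup S i ∧ lookup S j) ∨ eqᵇ i j ∨ adj G i j) (allFin n)) (allFin n)

  cliquePlusᵇ : Fin n → Fin n → Subset n → Bool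
  cliquePlusᵇ u v S = all (λ i → all (λ j →
     not (lookup S i ∧ lookup S j) ∨ eqᵇ i j ∨ adj G i j
       ∨ (eqᵇ i u ∧ eqᵇ j v) ∨ (eqᵇ i v ∧ eqᵇ j u)) (allFin n)) (allFin n)

allSubsets : (n : ℕ) → List (Subset n)
allSubsets zero = [] ∷ []
allSubsets (suc n) = map (false ∷_) (allSubsets n) ++ map (true ∷_) (allSubsets n)

module _ {n : ℕ} (G : SimpleGraph n) where

  IsKClique : ℕ → Subset n → Set
  IsKClique k S = (∣ S ∣ ≡ k) × (cliqueᵇ G S ≡ true)

  HasK : ℕ → Set
  HasK k = ∃ λ (S : Subset n) → IsKClique k S

  HasKPlus : ℕ → Fin n → Fin n → Set
  HasKPlus k u v = ∃ λ (S : Subset n) → (∣ S ∣ ≡ k) × (cliquePlusᵇ G u v S ≡ true)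

  Saturated : ℕ → Set
  Saturated s = (¬ HasK s) × (∀ u v → u ≢ v → ¬ E G u v → HasKPlus s u v)

  isKᵇ : ℕ → Subset n → Bool
  isKᵇ k S = ⌊ Data.Nat._≟_ ∣ S ∣ k ⌋ ∧ cliqueᵇ G S

  numK : ℕ → ℕ
  numK k = sum (map (λ S → if isKᵇ k S then 1 else 0) (allSubsets n))

  E1ᵇ : ℕ → Fin n → Fin n → Bool
  E1ᵇ r u w = adj G u w ∧ any (λ S → isKᵇ r S ∧ lookup S u ∧ lookup S w) (allSubsets n)

  deg1 : ℕ → Fin n → ℕ
  deg1 r v = sum (map (λ w → if E1ᵇ r v w then 1 else 0) (allFin n))

  -- v ∈ A  :⇔  d_{G_1}(v) ≤ n^{1/3}  ⇔  d_{G_1}(v)^3 ≤ n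
  InA : ℕ → Fin n → Set
  InA r v = deg1 r v ^ 3 ≤ n

  -- v, x_1, …, x_k (x : Fin k → Fin n) are distinct and pairwise adjacent,
  -- i.e. they induce a copy of K_{k+1}
  InducesK : Fin n → {k : ℕ} → (Fin k → Fin n) → Set
  InducesK v {k} x = (∀ i → v ≢ x i) × (∀ i → E G v (x i))
                   × (∀ i j → i ≢ j → (x i ≢ x j) × E G (x i) (x j))

  InB : ℕ → ℕ → Fin n → Set
  InB r s v = InA r v × ∃ λ (a : Fin (s ∸ 2) → Fin n) → (∀ i → ¬ InA r (a i)) × InducesK v a

  InC : ℕ → ℕ → Fin n → Set
  InC r s v = InB r s v × (s ∸ 2 < deg1 r v)

IsSat : (n r s m : ℕ) → Set
IsSat n r s m = (∃ λ (H : SimpleGraph n) → Saturated H s × numK H r ≡ m)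
              × (∀ (H : SimpleGraph n) → Saturated H s → m ≤ numK H r)

-- Saturation gives a copy S of K_s in G + uv, and S contains both u and v because G itself
-- is K_s-free. If u were not adjacent to x_i, then x_i ∉ S, and in G_1 the vertex v would be
-- joined to the s − 2 vertices of S ∖ {u, v} (all lying in the (s−1)-clique S ∖ {u}) and to
-- x_i (lying in the (s−1)-clique {v, x_1, …, x_{s−2}}). Since s − 1 ≥ r, these edges are in
-- copies of K_r, so d_{G_1}(v) ≥ s − 1, contradicting v ∉ C.
module Submission where

open import Defs renaming (sym to adj-sym)
open import Data.Bool using (Bool; true; false; T; _∧_; _∨_; not; if_then_else_)
  renaming (_≟_ to _≟ᵇ_)
open import Data.Bool.Properties using (T-≡; T-∧; T-∨)
open import Data.Bool.ListAction using (all; any)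
open import Data.Empty using (⊥-elim)
open import Data.Fin using (Fin; zero; suc) renaming (_≟_ to _≟ᶠ_)
open import Data.Fin.Properties using (0≢1+n; suc-injective)
open import Data.Fin.Subset using (Subset; _∈_; _∉_; _⊆_; _∪_; _-_; ⁅_⁆; ∣_∣)
  renaming (⊥ to ∅)
open import Data.Fin.Subset.Properties
  using (_∈?_; ∉⊥; ∣⊥∣≡0; x∈⁅x⁆; x∈⁅y⁆⇒x≡y; ∣⁅x⁆∣≡1; x≢y⇒x∉⁅y⁆; x∈p∪q⁺; x∈p∪q⁻; ∪-identityˡ;
         p─⊥≡p; p─q⊆p; x∈p∧x≢y⇒x∈p-y; drop-not-there; drop-∷-⊆; s⊆s; out⊆; p⊆q⇒∣p∣≤∣q∣)
open import Data.List using (allFin; map)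
import Data.List as List
open import Data.List.Properties using (map-tabulate)
import Data.List.Relation.Unary.All as All
open import Data.List.Relation.Unary.All.Properties using (all⁺; all⁻)
import Data.List.Relation.Unary.Any as Any
open import Data.List.Relation.Unary.Any.Properties using (any⁺)
open import Data.List.Membership.Propositional using (lose) renaming (_∈_ to _∈ˡ_)
open import Data.List.Membership.Propositional.Properties using (∈-allFin; ∈-map⁺; ∈-++⁺ˡ; ∈-++⁺ʳ)
open import Data.Nat using (ℕ; zero; suc; _*_; _+_; _∸_; _≤_; _<_; z≤n; s≤s; _≤?_)
open import Data.Nat.ListAction using (sum)
open import Data.Nat.Properties using (≤-antisym; ≰⇒>)
import Data.Nat.Properties as ℕ
open import Data.Product using (∃; _×_; _,_; proj₁; proj₂)
open import Data.Sum using (_⊎_; inj₁; inj₂; [_,_]′)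
open import Data.Vec using ([]; _∷_; lookup; tabulate; here; there)
open import Data.Vec.Properties using ([]=⇒lookup; lookup⇒[]=; lookup∘tabulate)
import Data.Vec.Functional as Vector
open import Function using (_∘_; _$_; id)
open import Function.Bundles using (Equivalence)
open import Function.Definitions using (Injective)
open import Relation.Nullary using (¬_; yes; no)
open import Relation.Nullary.Decidable using (toWitness; fromWitness; decidable-stable)
open import Relation.Binary.PropositionalEquality using (_≡_; _≢_; refl; sym; trans; cong; subst)
open Equivalence using (to; from)

private
  variable
    n : ℕ

∈-allSubsets : (S : Subset n) → S ∈ˡ allSubsets n
∈-allSubsets [] = Any.here refl
∈-allSubsets {suc n} (false ∷ S) = ∈-++⁺ˡ (∈-map⁺ (false ∷_) (∈-allSubsets S))
∈-allSubsets {suc n} (true ∷ S) =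
  ∈-++⁺ʳ (map (false ∷_) (allSubsets n)) (∈-map⁺ (true ∷_) (∈-allSubsets S))

all-allFin⁺ : (p : Fin n → Bool) → (∀ i → p i ≡ true) → all p (allFin n) ≡ true
all-allFin⁺ p h = to T-≡ (all⁻ p {allFin _} (All.tabulate λ {i} _ → from T-≡ (h i)))

all-allFin⁻ : (p : Fin n → Bool) → all p (allFin n) ≡ true → ∀ i → p i ≡ true
all-allFin⁻ p h i = to T-≡ (All.lookup (all⁺ p _ (from T-≡ h)) (∈-allFin i))

any-allSubsets⁺ : (p : Subset n → Bool) {S : Subset n} → p S ≡ true → any p (allSubsets n) ≡ true
any-allSubsets⁺ p {S} h = to T-≡ (any⁺ p (lose (∈-allSubsets S) (from T-≡ h)))

∧-intro : ∀ {a b} → a ≡ true → b ≡ true → a ∧ b ≡ true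
∧-intro refl refl = refl

sum-indicator≡∣tabulate∣ : (f : Fin n → Bool) →
  sum (map (λ i → if f i then 1 else 0) (allFin n)) ≡ ∣ tabulate f ∣
sum-indicator≡∣tabulate∣ {n} f =
  trans (cong sum (map-tabulate {n = n} id (λ i → if f i then 1 else 0))) (go f)
  where
  go : ∀ {n} (f : Fin n → Bool) → sum (List.tabulate (λ i → if f i then 1 else 0)) ≡ ∣ tabulate f ∣
  go {zero} f = refl
  go {suc n} f with f zero
  ... | true = cong suc (go (f ∘ suc))
  ... | false = go (f ∘ suc)

∣⁅x⁆∪p∣≡1+∣p∣ : {x : Fin n} {p : Subset n} → x ∉ p → ∣ ⁅ x ⁆ ∪ p ∣ ≡ suc ∣ p ∣
∣⁅x⁆∪p∣≡1+∣p∣ {x = zero}  {true ∷ p}  x∉p = ⊥-elim (x∉p here)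
∣⁅x⁆∪p∣≡1+∣p∣ {x = zero}  {false ∷ p} x∉p = cong (suc ∘ ∣_∣) (∪-identityˡ p)
∣⁅x⁆∪p∣≡1+∣p∣ {x = suc x} {true ∷ p}  x∉p = cong suc (∣⁅x⁆∪p∣≡1+∣p∣ (drop-not-there x∉p))
∣⁅x⁆∪p∣≡1+∣p∣ {x = suc x} {false ∷ p} x∉p = ∣⁅x⁆∪p∣≡1+∣p∣ (drop-not-there x∉p)

1+∣p-x∣≡∣p∣ : {x : Fin n} {p : Subset n} → x ∈ p → suc ∣ p - x ∣ ≡ ∣ p ∣
1+∣p-x∣≡∣p∣ {x = zero}  {true ∷ p}  here         = cong (suc ∘ ∣_∣) (p─⊥≡p p)
1+∣p-x∣≡∣p∣ {x = suc x} {true ∷ p}  (there x∈p) = cong suc (1+∣p-x∣≡∣p∣ x∈p)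
1+∣p-x∣≡∣p∣ {x = suc x} {false ∷ p} (there x∈p) = 1+∣p-x∣≡∣p∣ x∈p

x∈p-y⇒x≢y : {x y : Fin n} {p : Subset n} → x ∈ p - y → x ≢ y
x∈p-y⇒x≢y {x = zero}  {zero}  {_ ∷ _} ()
x∈p-y⇒x≢y {x = zero}  {suc y} _ = 0≢1+n
x∈p-y⇒x≢y {x = suc x} {zero}  _ = 0≢1+n ∘ sym
x∈p-y⇒x≢y {x = suc x} {suc y} {_ ∷ _} (there x∈p-y) = x∈p-y⇒x≢y x∈p-y ∘ suc-injective

∃-⊆-between : {p q : Subset n} {k : ℕ} → p ⊆ q → ∣ p ∣ ≤ k → k ≤ ∣ q ∣ →
              ∃ λ t → p ⊆ t × t ⊆ q × ∣ t ∣ ≡ k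
∃-⊆-between {p = []} {[]} _ _ z≤n = [] , id , id , refl
∃-⊆-between {p = true ∷ p} {false ∷ q} p⊆q _ _ with p⊆q here
... | ()
∃-⊆-between {p = true ∷ p} {true ∷ q} {suc k} p⊆q (s≤s ∣p∣≤k) (s≤s k≤∣q∣)
  with ∃-⊆-between (drop-∷-⊆ p⊆q) ∣p∣≤k k≤∣q∣
... | t , p⊆t , t⊆q , ∣t∣≡k = true ∷ t , s⊆s p⊆t , s⊆s t⊆q , cong suc ∣t∣≡k
∃-⊆-between {p = false ∷ p} {false ∷ q} p⊆q ∣p∣≤k k≤∣q∣
  with ∃-⊆-between (drop-∷-⊆ p⊆q) ∣p∣≤k k≤∣q∣
... | t , p⊆t , t⊆q , ∣t∣≡k = false ∷ t , s⊆s p⊆t , s⊆s t⊆q , ∣t∣≡k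
∃-⊆-between {p = false ∷ p} {true ∷ q} {k} p⊆q ∣p∣≤k k≤1+∣q∣ with k ≤? ∣ q ∣
... | yes k≤∣q∣ with ∃-⊆-between (drop-∷-⊆ p⊆q) ∣p∣≤k k≤∣q∣
...   | t , p⊆t , t⊆q , ∣t∣≡k = false ∷ t , s⊆s p⊆t , out⊆ t⊆q , ∣t∣≡k
∃-⊆-between {p = false ∷ p} {true ∷ q} p⊆q ∣p∣≤k k≤1+∣q∣ | no k≰∣q∣ =
  true ∷ q , out⊆ (drop-∷-⊆ p⊆q) , id , ≤-antisym (≰⇒> k≰∣q∣) k≤1+∣q∣

image : ∀ {m} → (Fin m → Fin n) → Subset n
image {m = zero}  g = ∅
image {m = suc m} g = ⁅ g zero ⁆ ∪ image (g ∘ suc)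

∈-image⁻ : ∀ {m} (g : Fin m → Fin n) {w} → w ∈ image g → ∃ λ i → w ≡ g i
∈-image⁻ {m = zero}  g w∈ = ⊥-elim (∉⊥ w∈)
∈-image⁻ {m = suc m} g w∈ with x∈p∪q⁻ ⁅ g zero ⁆ (image (g ∘ suc)) w∈
... | inj₁ w∈⁅g0⁆ = zero , x∈⁅y⁆⇒x≡y (g zero) w∈⁅g0⁆
... | inj₂ w∈image with ∈-image⁻ (g ∘ suc) w∈image
...   | i , w≡gi = suc i , w≡gi

∈-image⁺ : ∀ {m} (g : Fin m → Fin n) i → g i ∈ image g
∈-image⁺ g zero    = x∈p∪q⁺ (inj₁ (x∈⁅x⁆ (g zero)))
∈-image⁺ g (suc i) = x∈p∪q⁺ (inj₂ (∈-image⁺ (g ∘ suc) i))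

∣image∣ : ∀ {m} (g : Fin m → Fin n) → Injective _≡_ _≡_ g → ∣ image g ∣ ≡ m
∣image∣ {n} {zero}  g _   = ∣⊥∣≡0 n
∣image∣ {m = suc m} g inj =
  trans (∣⁅x⁆∪p∣≡1+∣p∣ g0∉) (cong suc (∣image∣ (g ∘ suc) (suc-injective ∘ inj)))
  where
  g0∉ : g zero ∉ image (g ∘ suc)
  g0∉ g0∈ with ∈-image⁻ (g ∘ suc) g0∈
  ... | i , g0≡gi = 0≢1+n (inj g0≡gi)

IsClique : SimpleGraph n → Subset n → Set
IsClique G S = ∀ {i j} → i ∈ S → j ∈ S → i ≢ j → E G i j

module _ (G : SimpleGraph n) where

  E-sym : ∀ {i j} → E G i j → E G j i
  E-sym {i} {j} = trans (adj-sym G j i)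

  IsClique-⊆ : ∀ {S T} → T ⊆ S → IsClique G S → IsClique G T
  IsClique-⊆ T⊆S clique i∈T j∈T = clique (T⊆S i∈T) (T⊆S j∈T)

  image-IsClique : ∀ {m} {g : Fin m → Fin n} → (∀ a b → a ≢ b → E G (g a) (g b)) →
                   IsClique G (image g)
  image-IsClique {g = g} adjacent i∈ j∈ i≢j with ∈-image⁻ g i∈ | ∈-image⁻ g j∈
  ... | a , refl | b , refl = adjacent a b (i≢j ∘ cong g)

  InducesK⇒injective : ∀ {v k} {x : Fin k → Fin n} → InducesK G v x →
                       Injective _≡_ _≡_ (v Vector.∷ x)
  InducesK⇒injective _ {zero} {zero} _ = refl
  InducesK⇒injective (v≢x , _) {zero} {suc b} v≡xb = ⊥-elim (v≢x b v≡xb)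
  InducesK⇒injective (v≢x , _) {suc a} {zero} xa≡v = ⊥-elim (v≢x a (sym xa≡v))
  InducesK⇒injective (_ , _ , x-pairwise) {suc a} {suc b} xa≡xb with a ≟ᶠ b
  ... | yes a≡b = cong suc a≡b
  ... | no a≢b = ⊥-elim (proj₁ (x-pairwise a b a≢b) xa≡xb)

  InducesK⇒adjacent : ∀ {v k} {x : Fin k → Fin n} → InducesK G v x →
                      ∀ a b → a ≢ b → E G ((v Vector.∷ x) a) ((v Vector.∷ x) b)
  InducesK⇒adjacent _ zero zero a≢b = ⊥-elim (a≢b refl)
  InducesK⇒adjacent (_ , v~x , _) zero (suc b) _ = v~x b
  InducesK⇒adjacent (_ , v~x , _) (suc a) zero _ = E-sym (v~x a)
  InducesK⇒adjacent (_ , _ , x-pairwise) (suc a) (suc b) a≢b =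
    proj₂ (x-pairwise a b (a≢b ∘ cong suc))

  cliqueᵇ-complete : ∀ {S} → IsClique G S → cliqueᵇ G S ≡ true
  cliqueᵇ-complete {S} clique = all-allFin⁺ _ λ i → all-allFin⁺ _ (pair i)
    where
    pair : ∀ i j → (not (lookup S i ∧ lookup S j) ∨ eqᵇ G i j ∨ adj G i j) ≡ true
    pair i j with lookup S i in i∈S | lookup S j in j∈S | i ≟ᶠ j
    ... | false | _     | _       = refl
    ... | true  | false | _       = refl
    ... | true  | true  | yes _   = refl
    ... | true  | true  | no i≢j = clique (lookup⇒[]= i S i∈S) (lookup⇒[]= j S j∈S) i≢j

  cliquePlusᵇ-sound : ∀ {u v S} → cliquePlusᵇ G u v S ≡ true →
                      ∀ {i j} → i ∈ S → j ∈ S → i ≢ j →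
                      E G i j ⊎ (i ≡ u × j ≡ v) ⊎ (i ≡ v × j ≡ u)
  cliquePlusᵇ-sound {u} {v} {S} plus {i} {j} i∈S j∈S i≢j =
    decode (from T-≡ (members-only ([]=⇒lookup i∈S) ([]=⇒lookup j∈S)
                                   (all-allFin⁻ _ (all-allFin⁻ _ plus i) j)))
    where
    members-only : ∀ {a b c} → a ≡ true → b ≡ true → (not (a ∧ b) ∨ c) ≡ true → c ≡ true
    members-only refl refl c = c

    decode : T (eqᵇ G i j ∨ adj G i j ∨ (eqᵇ G i u ∧ eqᵇ G j v) ∨ (eqᵇ G i v ∧ eqᵇ G j u)) →
             E G i j ⊎ (i ≡ u × j ≡ v) ⊎ (i ≡ v × j ≡ u)
    decode t with to (T-∨ {eqᵇ G i j}) t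
    ... | inj₁ i≡j = ⊥-elim (i≢j (toWitness i≡j))
    ... | inj₂ t with to (T-∨ {adj G i j}) t
    ...   | inj₁ i~j = inj₁ (to T-≡ i~j)
    ...   | inj₂ t with to (T-∨ {eqᵇ G i u ∧ eqᵇ G j v}) t
    ...     | inj₁ uv = let i≡u , j≡v = to (T-∧ {eqᵇ G i u}) uv
                        in inj₂ (inj₁ (toWitness i≡u , toWitness j≡v))
    ...     | inj₂ vu = let i≡v , j≡u = to (T-∧ {eqᵇ G i v}) vu
                        in inj₂ (inj₂ (toWitness i≡v , toWitness j≡u))

  cliquePlusᵇ-IsClique : ∀ {u v S T} → cliquePlusᵇ G u v S ≡ true → T ⊆ S → u ∉ T ⊎ v ∉ T →
                         IsClique G T
  cliquePlusᵇ-IsClique plus T⊆S u∉T⊎v∉T i∈T j∈T i≢j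
    with cliquePlusᵇ-sound plus (T⊆S i∈T) (T⊆S j∈T) i≢j
  ... | inj₁ i~j = i~j
  ... | inj₂ (inj₁ (refl , refl)) = ⊥-elim ([ _$ i∈T , _$ j∈T ]′ u∉T⊎v∉T)
  ... | inj₂ (inj₂ (refl , refl)) = ⊥-elim ([ _$ j∈T , _$ i∈T ]′ u∉T⊎v∉T)

  E1ᵇ-complete : ∀ {r S v w} → ∣ S ∣ ≡ r → IsClique G S → v ∈ S → w ∈ S → v ≢ w →
                 E1ᵇ G r v w ≡ true
  E1ᵇ-complete {r} {S} {v} {w} ∣S∣≡r clique v∈S w∈S v≢w =
    ∧-intro (clique v∈S w∈S v≢w)
      (any-allSubsets⁺ _ {S} (∧-intro isK (∧-intro ([]=⇒lookup v∈S) ([]=⇒lookup w∈S))))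
    where
    isK : isKᵇ G r S ≡ true
    isK = ∧-intro (to T-≡ (fromWitness {a? = ∣ S ∣ ℕ.≟ r} ∣S∣≡r)) (cliqueᵇ-complete clique)

  E1ᵇ-in-large-clique : ∀ {r T v w} → 2 ≤ r → r ≤ ∣ T ∣ → IsClique G T → v ∈ T → w ∈ T → v ≢ w →
                        E1ᵇ G r v w ≡ true
  E1ᵇ-in-large-clique {r} {T} {v} {w} 2≤r r≤∣T∣ clique v∈T w∈T v≢w =
    from-between (∃-⊆-between vw⊆T ∣vw∣≤r r≤∣T∣)
    where
    vw : Subset _
    vw = ⁅ v ⁆ ∪ ⁅ w ⁆

    vw⊆T : vw ⊆ T
    vw⊆T y∈vw with x∈p∪q⁻ ⁅ v ⁆ ⁅ w ⁆ y∈vw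
    ... | inj₁ y∈⁅v⁆ rewrite x∈⁅y⁆⇒x≡y v y∈⁅v⁆ = v∈T
    ... | inj₂ y∈⁅w⁆ rewrite x∈⁅y⁆⇒x≡y w y∈⁅w⁆ = w∈T

    ∣vw∣≤r : ∣ vw ∣ ≤ r
    ∣vw∣≤r = subst (_≤ r) (sym (trans (∣⁅x⁆∪p∣≡1+∣p∣ (x≢y⇒x∉⁅y⁆ v≢w)) (cong suc (∣⁅x⁆∣≡1 w)))) 2≤r

    from-between : (∃ λ S → vw ⊆ S × S ⊆ T × ∣ S ∣ ≡ r) → E1ᵇ G r v w ≡ true
    from-between (S , vw⊆S , S⊆T , ∣S∣≡r) =
      E1ᵇ-complete ∣S∣≡r (IsClique-⊆ S⊆T clique)
        (vw⊆S (x∈p∪q⁺ (inj₁ (x∈⁅x⁆ v)))) (vw⊆S (x∈p∪q⁺ (inj₂ (x∈⁅x⁆ w)))) v≢w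

  ∣p∣≤deg1 : ∀ {r v P} → (∀ {w} → w ∈ P → E1ᵇ G r v w ≡ true) → ∣ P ∣ ≤ deg1 G r v
  ∣p∣≤deg1 {r} {v} {P} P⊆N₁ =
    subst (∣ P ∣ ≤_) (sym (sum-indicator≡∣tabulate∣ (E1ᵇ G r v)))
      (p⊆q⇒∣p∣≤∣q∣ λ {w} w∈P →
        lookup⇒[]= w (tabulate (E1ᵇ G r v)) (trans (lookup∘tabulate _ w) (P⊆N₁ w∈P)))

  saturating-clique-∋-endpoints : ∀ {s u v S} → ¬ HasK G s → ∣ S ∣ ≡ s →
                                  cliquePlusᵇ G u v S ≡ true → u ∈ S × v ∈ S
  saturating-clique-∋-endpoints {u = u} {v} {S} noK ∣S∣≡s plus = member inj₁ , member inj₂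
    where
    member : ∀ {y} → (y ∉ S → u ∉ S ⊎ v ∉ S) → y ∈ S
    member {y} avoid = decidable-stable (y ∈? S) λ y∉S →
      noK (S , ∣S∣≡s , cliqueᵇ-complete (cliquePlusᵇ-IsClique plus id (avoid y∉S)))

  u≁xᵢ⇒1+k≤deg1 : ∀ {r k} → 2 ≤ r → r ≤ suc k → ¬ HasK G (suc (suc k)) →
                  ∀ {v} {x : Fin k → Fin n} → InducesK G v x →
                  ∀ {u} → u ≢ v → ¬ E G u v → HasKPlus G (suc (suc k)) u v →
                  ∀ i → ¬ E G u (x i) → suc k ≤ deg1 G r v
  u≁xᵢ⇒1+k≤deg1 {r} {k} 2≤r r≤1+k noK {v} {x} ind@(v≢x , v~x , _) {u} u≢v u≁v
                (S , ∣S∣≡2+k , plus) i u≁xᵢ =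
    subst (_≤ deg1 G r v) ∣P∣≡1+k (∣p∣≤deg1 P⊆N₁)
    where
    u∈S : u ∈ S
    u∈S = proj₁ (saturating-clique-∋-endpoints noK ∣S∣≡2+k plus)

    v∈S : v ∈ S
    v∈S = proj₂ (saturating-clique-∋-endpoints noK ∣S∣≡2+k plus)

    u≢xᵢ : u ≢ x i
    u≢xᵢ refl = u≁v (E-sym (v~x i))

    xᵢ∉S : x i ∉ S
    xᵢ∉S xᵢ∈S with cliquePlusᵇ-sound plus u∈S xᵢ∈S u≢xᵢ
    ... | inj₁ u~xᵢ              = u≁xᵢ u~xᵢ
    ... | inj₂ (inj₁ (_ , xᵢ≡v)) = v≢x i (sym xᵢ≡v)
    ... | inj₂ (inj₂ (u≡v , _))  = u≢v u≡v

    X : Subset n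
    X = image (v Vector.∷ x)

    r≤∣X∣ : r ≤ ∣ X ∣
    r≤∣X∣ = subst (r ≤_) (sym (∣image∣ _ (InducesK⇒injective ind))) r≤1+k

    S∖u : Subset n
    S∖u = S - u

    v∈S∖u : v ∈ S∖u
    v∈S∖u = x∈p∧x≢y⇒x∈p-y v∈S (u≢v ∘ sym)

    ∣S∖u∣≡1+k : ∣ S∖u ∣ ≡ suc k
    ∣S∖u∣≡1+k = ℕ.suc-injective (trans (1+∣p-x∣≡∣p∣ u∈S) ∣S∣≡2+k)

    S∖u-IsClique : IsClique G S∖u
    S∖u-IsClique = cliquePlusᵇ-IsClique plus (p─q⊆p S ⁅ u ⁆) (inj₁ λ u∈S∖u → x∈p-y⇒x≢y u∈S∖u refl)

    P : Subset n
    P = ⁅ x i ⁆ ∪ (S∖u - v)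

    ∣P∣≡1+k : ∣ P ∣ ≡ suc k
    ∣P∣≡1+k = trans (∣⁅x⁆∪p∣≡1+∣p∣ (xᵢ∉S ∘ p─q⊆p S ⁅ u ⁆ ∘ p─q⊆p S∖u ⁅ v ⁆))
                    (trans (1+∣p-x∣≡∣p∣ v∈S∖u) ∣S∖u∣≡1+k)

    P⊆N₁ : ∀ {w} → w ∈ P → E1ᵇ G r v w ≡ true
    P⊆N₁ w∈P with x∈p∪q⁻ ⁅ x i ⁆ (S∖u - v) w∈P
    ... | inj₁ w∈⁅xᵢ⁆ rewrite x∈⁅y⁆⇒x≡y (x i) w∈⁅xᵢ⁆ =
      E1ᵇ-in-large-clique 2≤r r≤∣X∣ (image-IsClique (InducesK⇒adjacent ind))
        (∈-image⁺ (v Vector.∷ x) zero) (∈-image⁺ (v Vector.∷ x) (suc i)) (v≢x i)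
    ... | inj₂ w∈S∖uv =
      E1ᵇ-in-large-clique 2≤r (subst (r ≤_) (sym ∣S∖u∣≡1+k) r≤1+k) S∖u-IsClique
        v∈S∖u (p─q⊆p S∖u ⁅ v ⁆ w∈S∖uv) (x∈p-y⇒x≢y w∈S∖uv ∘ sym)

lemma3p1 : (n r s : ℕ) → 2 ≤ r → r < s → (G : SimpleGraph n) → Saturated G s
    → (m : ℕ) → IsSat n r s m
    → 4 * r * r * numK G r ≤ 4 * r * r * m + n
    → (v : Fin n) → InB G r s v → ¬ InC G r s v
    → (x : Fin (s ∸ 2) → Fin n) → InducesK G v x
    → (u : Fin n) → u ≢ v → ¬ E G u v → (i : Fin (s ∸ 2)) → E G u (x i)
lemma3p1 _ _ zero _ () _ _ _ _ _ _ _ _ _ _ _ _ _ _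
lemma3p1 _ _ (suc zero) (s≤s (s≤s _)) (s≤s ()) _ _ _ _ _ _ _ _ _ _ _ _ _ _
lemma3p1 n r (suc (suc k)) 2≤r (s≤s r≤1+k) G (K_s-free , saturating) _ _ _
         v v∈B v∉C x ind u u≢v u≁v i with adj G u (x i) ≟ᵇ true
... | yes u~xᵢ = u~xᵢ
... | no u≁xᵢ =
  ⊥-elim (v∉C (v∈B , u≁xᵢ⇒1+k≤deg1 G 2≤r r≤1+k K_s-free ind u≢v u≁v
                                    (saturating u v u≢v u≁v) i u≁xᵢ))
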